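{- Let $G$ be a connected $3K_1$-free graph and let $u\in V(G)$. Then $G$ has a Hamiltonian path starting at $u$ (i.e., having $u$ as an end-vertex) if and only if $u$ is not an articulation point of $G$.
   Context: Graphs are finite, simple and undirected. A graph is $3K_1$-free if it contains no three pairwise non-adjacent vertices. A Hamiltonian path is a path containing all vertices of the graph. An articulation point of $G$ is a vertex $x$ such that $G-\{x\}$ is disconnected. -}

module Defs where

open import Data.Nat using (ℕ)
open import Data.Fin using (Fin)
open import Data.List using (List; []; _∷_)
open import Data.List.Membership.Propositional using (_∈_)
open import Data.List.Relation.Unary.All using (All)
open import Data.List.Relation.Unary.Unique.Propositional using (Unique)
open import Data.Product using (_×_; Σ; ∃)
open import Relation.Nullary using (¬_; Dec)
open import Relation.Binary.PropositionalEquality using (_≡_; _≢_)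
open import Level using (0ℓ)

record Graph (n : ℕ) : Set₁ where
  field
    Adj     : Fin n → Fin n → Set
    adj?    : ∀ x y → Dec (Adj x y)
    sym     : ∀ {x y} → Adj x y → Adj y x
    irrefl  : ∀ {x} → ¬ Adj x x
open Graph public

module _ {n : ℕ} (G : Graph n) where

  Chain : List (Fin n) → Set
  Chain []            = Data.Unit.⊤ where import Data.Unit
  Chain (x ∷ [])      = Data.Unit.⊤ where import Data.Unit
  Chain (x ∷ y ∷ xs)  = Adj G x y × Chain (y ∷ xs)

  Head : List (Fin n) → Fin n → Set
  Head []      u = Data.Empty.⊥ where import Data.Empty
  Head (x ∷ _) u = x ≡ u

  Last : List (Fin n) → Fin n → Set
  Last []           v = Data.Empty.⊥ where import Data.Empty
  Last (x ∷ [])     v = x ≡ v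
  Last (x ∷ y ∷ xs) v = Last (y ∷ xs) v

  WalkIn : (Fin n → Set) → Fin n → Fin n → Set
  WalkIn P u v = Σ (List (Fin n)) λ w →
    Head w u × Last w v × Chain w × All P w

  Connected : Set
  Connected = ∀ u v → WalkIn (λ _ → Data.Unit.⊤) u v
    where import Data.Unit

  ConnectedWithout : Fin n → Set
  ConnectedWithout x = ∀ u v → u ≢ x → v ≢ x → WalkIn (λ z → z ≢ x) u v

  ArticulationPoint : Fin n → Set
  ArticulationPoint x = ¬ ConnectedWithout x

  ThreeK1Free : Set
  ThreeK1Free = ∀ a b c → a ≢ b → b ≢ c → a ≢ c →
    ¬ (¬ Adj G a b × ¬ Adj G b c × ¬ Adj G a c)

  HamiltonianPath : List (Fin n) → Set
  HamiltonianPath p = Unique p × Chain p × (∀ v → v ∈ p)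

  HamPathFrom : Fin n → Set
  HamPathFrom u = Σ (List (Fin n)) λ p → HamiltonianPath p × Head p u

-- If u starts a Hamiltonian path, the rest of the path runs through every other vertex
-- while avoiding u, so G − u is connected.
-- Conversely, in a connected 3K₁-free graph a path P missing a vertex x can always be
-- lengthened. If x is adjacent to an end of P it is attached there. Otherwise the two ends
-- of P are adjacent (with x they would form an independent triple), so P closes up into a
-- cycle, which is reopened at the endpoint of an edge leaving P. Growing a path this way in
-- G − u yields a Hamiltonian path of G − u; one more extension inside G can only add u,
-- and adds it at an end.

module Submission where

open import Defs
open import Data.Nat using (ℕ; zero; suc; _+_; _≤_)
open import Data.Nat.Properties using (+-suc; +-identityʳ; 1+n≰n)
open import Data.Fin using (Fin; zero; suc; _≟_)
open import Data.Fin.Properties using (any?; injective⇒≤)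
open import Data.Empty using (⊥-elim)
open import Data.Unit using (⊤; tt)
open import Data.Product using (_×_; Σ; _,_)
open import Data.List using (List; []; _∷_; _++_; length; lookup; reverse)
open import Data.List.Properties using (unfold-reverse)
open import Data.List.Membership.Propositional using (_∈_; _∉_)
open import Data.List.Membership.Propositional.Properties using (∈-++⁺ʳ; ∈-∃++; ∈-lookup)
open import Data.List.Relation.Unary.Any using (here; there)
import Data.List.Relation.Unary.Any as Any
open import Data.List.Relation.Unary.All using (All; []; _∷_)
import Data.List.Relation.Unary.All as All
open import Data.List.Relation.Unary.All.Properties using (¬Any⇒All¬)
open import Data.List.Relation.Unary.AllPairs using ([]; _∷_)
open import Data.List.Relation.Unary.Unique.Propositional using (Unique)
open import Data.List.Relation.Binary.Permutation.Propositional
  using (_↭_; ↭-refl; ↭-sym; prep; ↭⇒↭ₛ)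
open import Data.List.Relation.Binary.Permutation.Propositional.Properties
  using (All-resp-↭; ∈-resp-↭; ↭-length; ++-comm; ↭-reverse)
import Data.List.Relation.Binary.Permutation.Setoid.Properties as Perm
open import Function.Definitions using (Injective)
open import Relation.Binary.PropositionalEquality
  using (_≡_; _≢_; refl; subst; cong; trans; ≢-sym; setoid) renaming (sym to ≡-sym)
open import Relation.Nullary using (¬_; Dec; yes; no; ¬?)
open import Relation.Nullary.Decidable using (decidable-stable; _×-dec_)
open import Relation.Unary using (Decidable)

unique-resp-↭ : ∀ {A : Set} {xs ys : List A} → xs ↭ ys → Unique xs → Unique ys
unique-resp-↭ {A} xs↭ys = Perm.Unique-resp-↭ (setoid A) (↭⇒↭ₛ xs↭ys)

lookup-injective : ∀ {A : Set} {xs : List A} → Unique xs → Injective _≡_ _≡_ (lookup xs)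
lookup-injective {xs = _ ∷ _} _            {zero}  {zero}  _  = refl
lookup-injective {xs = _ ∷ _} (x∉ ∷ _)     {zero}  {suc j} eq = ⊥-elim (All.lookup x∉ (∈-lookup j) eq)
lookup-injective {xs = _ ∷ _} (x∉ ∷ _)     {suc i} {zero}  eq =
  ⊥-elim (All.lookup x∉ (∈-lookup i) (≡-sym eq))
lookup-injective {xs = _ ∷ _} (_ ∷ unique) {suc i} {suc j} eq = cong suc (lookup-injective unique eq)

unique⇒length≤ : ∀ {n} {xs : List (Fin n)} → Unique xs → length xs ≤ n
unique⇒length≤ unique = injective⇒≤ (lookup-injective unique)

unique-++⇒disjoint : ∀ {A : Set} (xs : List A) {ys a b} →
  Unique (xs ++ ys) → a ∈ xs → b ∈ ys → a ≢ b
unique-++⇒disjoint (x ∷ xs) (x∉ ∷ _)      (here refl) b∈ = All.lookup x∉ (∈-++⁺ʳ xs b∈)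
unique-++⇒disjoint (x ∷ xs) (_ ∷ unique) (there a∈)  b∈ = unique-++⇒disjoint xs unique a∈ b∈

module _ {n : ℕ} (G : Graph n) where

  private
    V : Set
    V = Fin n

  head-unique : ∀ (xs : List V) {a b} → Head G xs a → Head G xs b → a ≡ b
  head-unique (x ∷ xs) refl refl = refl

  last-unique : ∀ (xs : List V) {a b} → Last G xs a → Last G xs b → a ≡ b
  last-unique (x ∷ [])     refl refl = refl
  last-unique (x ∷ y ∷ xs) la   lb   = last-unique (y ∷ xs) la lb

  head-∈ : ∀ (xs : List V) {a} → Head G xs a → a ∈ xs
  head-∈ (x ∷ xs) refl = here refl

  last-∈ : ∀ (xs : List V) {a} → Last G xs a → a ∈ xs
  last-∈ (x ∷ [])     refl = here refl
  last-∈ (x ∷ y ∷ xs) la   = there (last-∈ (y ∷ xs) la)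

  head-++ : ∀ (xs ys : List V) {a} → Head G xs a → Head G (xs ++ ys) a
  head-++ (x ∷ xs) ys ha = ha

  last-++ : ∀ (xs ys : List V) {a} → Last G ys a → Last G (xs ++ ys) a
  last-++ []            ys       la = la
  last-++ (x ∷ [])      (y ∷ ys) la = la
  last-++ (x ∷ x' ∷ xs) ys       la = last-++ (x' ∷ xs) ys la

  lastOf : V → List V → V
  lastOf x []       = x
  lastOf _ (y ∷ ys) = lastOf y ys

  last-lastOf : ∀ x xs → Last G (x ∷ xs) (lastOf x xs)
  last-lastOf x []       = refl
  last-lastOf x (y ∷ ys) = last-lastOf y ys

  reverse-last : ∀ (xs : List V) {a} → Head G xs a → Last G (reverse xs) a
  reverse-last (x ∷ xs) refl =
    subst (λ r → Last G r x) (≡-sym (unfold-reverse x xs)) (last-++ (reverse xs) (x ∷ []) refl)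

  reverse-head : ∀ (xs : List V) {a} → Last G xs a → Head G (reverse xs) a
  reverse-head (x ∷ [])     la = la
  reverse-head (x ∷ y ∷ xs) {a} la =
    subst (λ r → Head G r a) (≡-sym (unfold-reverse x (y ∷ xs)))
      (head-++ (reverse (y ∷ xs)) (x ∷ []) (reverse-head (y ∷ xs) la))

  chain-∷ : ∀ {x} (xs : List V) → (∀ {h} → Head G xs h → Adj G x h) → Chain G xs → Chain G (x ∷ xs)
  chain-∷ []       _   _ = tt
  chain-∷ (y ∷ ys) adj c = adj refl , c

  chain-tail : ∀ {x} (xs : List V) → Chain G (x ∷ xs) → Chain G xs
  chain-tail []       _       = tt
  chain-tail (y ∷ ys) (_ , c) = c

  chain-++ : ∀ (xs ys : List V) → Chain G xs → Chain G ys →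
    (∀ {a b} → Last G xs a → Head G ys b → Adj G a b) → Chain G (xs ++ ys)
  chain-++ []            ys       _        cy _    = cy
  chain-++ (x ∷ [])      []       _        _  _    = tt
  chain-++ (x ∷ [])      (y ∷ ys) _        cy join = join refl refl , cy
  chain-++ (x ∷ x' ∷ xs) ys       (e , cx) cy join = e , chain-++ (x' ∷ xs) ys cx cy join

  chain-++⁻ : ∀ (xs ys : List V) → Chain G (xs ++ ys) → Chain G xs × Chain G ys
  chain-++⁻ []            ys       c       = tt , c
  chain-++⁻ (x ∷ [])      []       _       = tt , tt
  chain-++⁻ (x ∷ [])      (y ∷ ys) (_ , c) = tt , c
  chain-++⁻ (x ∷ x' ∷ xs) ys       (e , c) with chain-++⁻ (x' ∷ xs) ys c
  ... | cx , cy = (e , cx) , cy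

  reverse-join : ∀ x (xs : List V) → Chain G (x ∷ xs) → ∀ {a} → Last G (reverse xs) a → Adj G a x
  reverse-join x []       _       ()
  reverse-join x (y ∷ ys) (e , _) la =
    subst (λ a → Adj G a x) (last-unique (reverse (y ∷ ys)) (reverse-last (y ∷ ys) refl) la) (sym G e)

  chain-reverse : ∀ (xs : List V) → Chain G xs → Chain G (reverse xs)
  chain-reverse []       _ = tt
  chain-reverse (x ∷ xs) c = subst (Chain G) (≡-sym (unfold-reverse x xs))
    (chain-++ (reverse xs) (x ∷ []) (chain-reverse xs (chain-tail xs c)) tt
      (λ { la refl → reverse-join x xs c la }))

  EndsAdjacent : List V → Set
  EndsAdjacent xs = ∀ {a b} → Head G xs a → Last G xs b → a ≢ b → Adj G b a

  rotate-chain : ∀ (xs ys : List V) → Unique (xs ++ ys) → Chain G (xs ++ ys) → EndsAdjacent (xs ++ ys) →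
    Chain G (ys ++ xs)
  rotate-chain xs ys unique c ends with chain-++⁻ xs ys c
  ... | cx , cy = chain-++ ys xs cy cx λ la hb →
    ends (head-++ xs ys hb) (last-++ xs ys la)
      (unique-++⇒disjoint xs unique (head-∈ xs hb) (last-∈ ys la))

  reroot : ∀ {xs : List V} {v} → Unique xs → Chain G xs → EndsAdjacent xs → v ∈ xs →
    Σ (List V) λ ys → ys ↭ xs × Chain G ys × Head G ys v
  reroot unique c ends v∈ with ∈-∃++ v∈
  ... | ys , zs , refl = (_ ∷ zs) ++ ys , ++-comm (_ ∷ zs) ys , rotate-chain ys (_ ∷ zs) unique c ends , refl

  data Walk (P : V → Set) : V → V → Set where
    [_]    : ∀ {a} → P a → Walk P a a
    _∷⟨_⟩_ : ∀ {a b c} → P a → Adj G a b → Walk P b c → Walk P a c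

  walkIn⇒walk : ∀ {P a b} → WalkIn G P a b → Walk P a b
  walkIn⇒walk (w , ha , lb , c , ps) = go w ha lb c ps
    where
      go : ∀ {P} (w : List V) {a b} → Head G w a → Last G w b → Chain G w → All P w → Walk P a b
      go (x ∷ [])     refl refl _       (px ∷ []) = [ px ]
      go (x ∷ y ∷ w)  refl lb   (e , c) (px ∷ ps) = px ∷⟨ e ⟩ go (y ∷ w) refl lb c ps

  walk⇒walkIn : ∀ {P a b} → Walk P a b → WalkIn G P a b
  walk⇒walkIn [ pa ] = _ ∷ [] , refl , refl , tt , pa ∷ []
  walk⇒walkIn (pa ∷⟨ e ⟩ w) with walk⇒walkIn w
  ... | y ∷ l , refl , lb , c , ps = _ ∷ y ∷ l , refl , lb , (e , c) , pa ∷ ps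

  snocʷ : ∀ {P a b c} → Walk P a b → Adj G b c → P c → Walk P a c
  snocʷ [ pa ]        e pc = pa ∷⟨ e ⟩ [ pc ]
  snocʷ (pa ∷⟨ e' ⟩ w) e pc = pa ∷⟨ e' ⟩ snocʷ w e pc

  reverseʷ : ∀ {P a b} → Walk P a b → Walk P b a
  reverseʷ [ pa ]        = [ pa ]
  reverseʷ (pa ∷⟨ e ⟩ w) = snocʷ (reverseʷ w) (sym G e) pa

  _++ʷ_ : ∀ {P a b c} → Walk P a b → Walk P b c → Walk P a c
  [ _ ]         ++ʷ w' = w'
  (pa ∷⟨ e ⟩ w) ++ʷ w' = pa ∷⟨ e ⟩ (w ++ʷ w')

  walk-from-head : ∀ {P b} x (xs : List V) →
    Chain G (x ∷ xs) → All P (x ∷ xs) → b ∈ x ∷ xs → Walk P x b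
  walk-from-head x xs       _       (px ∷ _)  (here refl) = [ px ]
  walk-from-head x (y ∷ ys) (e , c) (px ∷ ps) (there b∈)  = px ∷⟨ e ⟩ walk-from-head y ys c ps b∈

  chain⇒walk : ∀ {P a b} (xs : List V) → Chain G xs → All P xs → a ∈ xs → b ∈ xs → Walk P a b
  chain⇒walk (x ∷ xs) c ps a∈ b∈ =
    reverseʷ (walk-from-head x xs c ps a∈) ++ʷ walk-from-head x xs c ps b∈

  hamPathFrom⇒connectedWithout : ∀ {u} → HamPathFrom G u → ConnectedWithout G u
  hamPathFrom⇒connectedWithout (_ ∷ t , (u∉t ∷ _ , c , covers) , refl) a b a≢u b≢u =
    walk⇒walkIn (chain⇒walk t (chain-tail t c) (All.map ≢-sym u∉t)
      (Any.tail a≢u (covers a)) (Any.tail b≢u (covers b)))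

  nonNeighbours-adjacent : ThreeK1Free G → ∀ {x a b} → x ≢ a → x ≢ b → a ≢ b →
    ¬ Adj G x a → ¬ Adj G x b → Adj G a b
  nonNeighbours-adjacent K {x} {a} {b} x≢a x≢b a≢b ¬xa ¬xb =
    decidable-stable (adj? G a b) λ ¬ab → K x a b x≢a a≢b x≢b (¬xa , ¬ab , ¬xb)

  ends-adjacent : ThreeK1Free G → ∀ {x} h (t : List V) → x ∉ h ∷ t →
    ¬ Adj G x h → ¬ Adj G x (lastOf h t) → EndsAdjacent (h ∷ t)
  ends-adjacent K h t x∉ ¬xh ¬xl refl lb h≢l with last-unique (h ∷ t) (last-lastOf h t) lb
  ... | refl = sym G (nonNeighbours-adjacent K (λ x≡h → x∉ (here x≡h))
    (λ x≡l → x∉ (subst (_∈ h ∷ t) (≡-sym x≡l) lb∈)) h≢l ¬xh ¬xl)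
    where
      lb∈ : lastOf h t ∈ h ∷ t
      lb∈ = last-∈ (h ∷ t) lb

  PathIn : (V → Set) → List V → Set
  PathIn S P = Unique P × Chain G P × All S P

  Covers : (V → Set) → List V → Set
  Covers S P = ∀ v → S v → v ∈ P

  record Extension (S : V → Set) (P : List V) : Set where
    field
      new        : V
      S-new      : S new
      new∉P      : new ∉ P
      rest       : List V
      rest↭P     : rest ↭ P
      rest-chain : Chain G rest
      new-adj    : ∀ {h} → Head G rest h → Adj G new h

    path : List V
    path = new ∷ rest

    path↭ : path ↭ new ∷ P
    path↭ = prep new rest↭P

    path-length : length path ≡ suc (length P)
    path-length = ↭-length path↭

    path-unique : Unique P → Unique path
    path-unique unique = unique-resp-↭ (↭-sym path↭) (¬Any⇒All¬ P new∉P ∷ unique)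

    path-chain : Chain G path
    path-chain = chain-∷ rest new-adj rest-chain

    path-all : All S P → All S path
    path-all ps = All-resp-↭ (↭-sym path↭) (S-new ∷ ps)

  ConnectedIn : (V → Set) → Set
  ConnectedIn S = ∀ a b → S a → S b → WalkIn G S a b

  CrossingEdge : (V → Set) → List V → Set
  CrossingEdge S P = Σ V λ y → Σ V λ v → S y × y ∉ P × v ∈ P × Adj G y v

  module _ {S : V → Set} (S? : Decidable S) where

    open import Data.List.Membership.DecPropositional (_≟_ {n}) using (_∈?_)

    walk⇒crossingEdge : ∀ P {a b} → Walk S a b → a ∉ P → b ∈ P → CrossingEdge S P
    walk⇒crossingEdge P [ _ ] a∉ b∈ = ⊥-elim (a∉ b∈)
    walk⇒crossingEdge P (_∷⟨_⟩_ {a} {c} sa e w) a∉ b∈ with c ∈? P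
    ... | yes c∈ = a , c , sa , a∉ , c∈ , e
    ... | no  c∉ = walk⇒crossingEdge P w c∉ b∈

    crossingEdge? : ∀ P → Dec (CrossingEdge S P)
    crossingEdge? P = any? λ y → any? λ v → S? y ×-dec ¬? (y ∈? P) ×-dec (v ∈? P) ×-dec adj? G y v

    -- Connectivity is only known doubly negated (ArticulationPoint is a negation),
    -- but a crossing edge is decidable, so one can still be extracted.
    crossingEdge : ¬ ¬ ConnectedIn S → ∀ P {a b} → S a → a ∉ P → S b → b ∈ P → CrossingEdge S P
    crossingEdge conn P sa a∉ sb b∈ = decidable-stable (crossingEdge? P) λ none →
      conn λ c → none (walk⇒crossingEdge P (walkIn⇒walk (c _ _ sa sb)) a∉ b∈)

    extend : ThreeK1Free G → ¬ ¬ ConnectedIn S →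
      ∀ P {x} → PathIn S P → S x → x ∉ P → Extension S P
    extend K conn [] _ sx x∉ = record
      { new = _ ; S-new = sx ; new∉P = x∉
      ; rest = [] ; rest↭P = ↭-refl ; rest-chain = tt ; new-adj = λ () }
    extend K conn (h ∷ t) {x} (unique , c , ps) sx x∉ with adj? G x h | adj? G x (lastOf h t)
    ... | yes xh | _ = record
      { new = x ; S-new = sx ; new∉P = x∉
      ; rest = h ∷ t ; rest↭P = ↭-refl ; rest-chain = c ; new-adj = λ { refl → xh } }
    ... | no _ | yes xl = record
      { new = x ; S-new = sx ; new∉P = x∉
      ; rest = reverse (h ∷ t) ; rest↭P = ↭-reverse (h ∷ t) ; rest-chain = chain-reverse (h ∷ t) c
      ; new-adj = λ hd → subst (Adj G x)
          (head-unique (reverse (h ∷ t)) (reverse-head (h ∷ t) (last-lastOf h t)) hd) xl }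
    ... | no ¬xh | no ¬xl with crossingEdge conn (h ∷ t) sx x∉ (All.head ps) (here refl)
    ...   | y , v , sy , y∉ , v∈ , yv with reroot unique c (ends-adjacent K h t x∉ ¬xh ¬xl) v∈
    ...     | r , r↭ , rc , rv = record
      { new = y ; S-new = sy ; new∉P = y∉
      ; rest = r ; rest↭P = r↭ ; rest-chain = rc
      ; new-adj = λ hd → subst (Adj G y) (head-unique r rv hd) yv }

    -- The fuel k only runs out when P has n vertices, and then nothing can be missing.
    grow : ThreeK1Free G → ¬ ¬ ConnectedIn S → ∀ k P → PathIn S P → k + length P ≡ n →
      Σ (List V) λ Q → PathIn S Q × Covers S Q
    grow K conn k P p len with any? (λ v → S? v ×-dec ¬? (v ∈? P))
    ... | no none = P , p , λ v sv → decidable-stable (v ∈? P) λ v∉ → none (v , sv , v∉)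
    grow K conn zero P (unique , _) len | yes (x , _ , x∉) =
      ⊥-elim (1+n≰n (subst (suc (length P) ≤_) (≡-sym len)
        (unique⇒length≤ (¬Any⇒All¬ P x∉ ∷ unique))))
    grow K conn (suc k) P (unique , c , ps) len | yes (x , sx , x∉) =
      grow K conn k path (path-unique unique , path-chain , path-all ps)
        (trans (cong (k +_) path-length) (trans (+-suc k (length P)) len))
      where open Extension (extend K conn P (unique , c , ps) sx x∉)

    coveringPath : ThreeK1Free G → ¬ ¬ ConnectedIn S → Σ (List V) λ Q → PathIn S Q × Covers S Q
    coveringPath K conn = grow K conn n [] ([] , tt , []) (+-identityʳ n)

  notArticulationPoint⇒hamPathFrom : Connected G → ThreeK1Free G → ∀ {u} →
    ¬ ArticulationPoint G u → HamPathFrom G u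
  notArticulationPoint⇒hamPathFrom conG K {u} noArt
    with coveringPath (λ z → ¬? (z ≟ u)) K noArt
  ... | Q , (unique , c , avoid) , covers = path , (path-unique unique , path-chain , covering) , new≡u
    where
      u∉Q : u ∉ Q
      u∉Q u∈ = All.lookup avoid u∈ refl

      open Extension (extend {S = λ _ → ⊤} (λ _ → yes tt) K (λ k → k λ a b _ _ → conG a b)
                        Q (unique , c , All.universal (λ _ → tt) Q) tt u∉Q)

      new≡u : new ≡ u
      new≡u = decidable-stable (new ≟ u) λ new≢u → new∉P (covers new new≢u)

      covering : ∀ v → v ∈ path
      covering v with v ≟ u
      ... | yes refl = here (≡-sym new≡u)
      ... | no  v≢u  = ∈-resp-↭ (↭-sym path↭) (there (covers v v≢u))

theorem2 : ∀ (n : ℕ) (G : Graph n) → Connected G → ThreeK1Free G →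
    (u : Fin n) → (HamPathFrom G u → ¬ ArticulationPoint G u) × (¬ ArticulationPoint G u → HamPathFrom G u)
theorem2 n G conG K u =
  (λ ham art → art (hamPathFrom⇒connectedWithout G ham)) , notArticulationPoint⇒hamPathFrom G conG K
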